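{- Let $n,m\ge 2$, let $2\le r\le n$ and $2\le s\le m$, let $A\subseteq V(K_n)$ with $|A|=r$ and $B\subseteq V(K_m)$ with $|B|=s$. If $S$ is a total $2$-dominating set of $K_n\Box K_m$, then \[ \Big|S\cap\big[(A\times V(K_m))\cup(V(K_n)\times B)\big]\Big|\ge \gamma_{2t}(K_r\Box K_s). \]
   Context: $K_n$ denotes the complete graph on $n$ vertices. The Cartesian product $G\Box H$ has vertex set $V(G)\times V(H)$, with $(u_1,v_1)\sim(u_2,v_2)$ iff either $u_1=u_2$ and $v_1\sim v_2$, or $v_1=v_2$ and $u_1\sim u_2$. A set $S$ of vertices of a graph $G$ is total $2$-dominating if every vertex of $G$ is adjacent to at least two vertices of $S$; $\gamma_{2t}(G)$ is the minimum cardinality of such a set. -}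

module Defs where

open import Data.Nat using (ℕ; zero; suc; _+_; _≤_)
open import Data.Bool using (Bool; true; false; _∧_; _∨_; not; if_then_else_)
open import Data.Fin using (Fin; zero; suc; _≟_)
open import Data.Fin.Subset using (Subset; _∈_)
open import Data.Vec using (lookup)
open import Data.Product using (_×_; Σ; _,_)
open import Relation.Binary.PropositionalEquality using (_≡_)
open import Relation.Nullary.Decidable using (⌊_⌋)

sumFin : {n : ℕ} → (Fin n → ℕ) → ℕ
sumFin {zero}  f = 0
sumFin {suc n} f = f zero + sumFin (λ i → f (suc i))

ind : Bool → ℕ
ind b = if b then 1 else 0

-- Vertices of K_n □ K_m are pairs (i , j) : Fin n × Fin m.
-- A vertex set of K_n □ K_m is given by its characteristic function.
VSet : ℕ → ℕ → Set
VSet n m = Fin n → Fin m → Bool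

card : {n m : ℕ} → VSet n m → ℕ
card S = sumFin (λ i → sumFin (λ j → ind (S i j)))

-- adjacency in K_n □ K_m (decided as a Boolean):
-- (i,j) ~ (i',j')  iff  (i = i' and j ≠ j') or (j = j' and i ≠ i')
-- (in K_k two vertices are adjacent iff they are distinct)
adj : {n m : ℕ} → Fin n → Fin m → Fin n → Fin m → Bool
adj i j i' j' =
  (⌊ i ≟ i' ⌋ ∧ not ⌊ j ≟ j' ⌋) ∨ (⌊ j ≟ j' ⌋ ∧ not ⌊ i ≟ i' ⌋)

nbrsIn : {n m : ℕ} → VSet n m → Fin n → Fin m → ℕ
nbrsIn S i j = card (λ i' j' → adj i j i' j' ∧ S i' j')

IsTotal2Dom : (n m : ℕ) → VSet n m → Set
IsTotal2Dom n m S = (i : Fin n) (j : Fin m) → 2 ≤ nbrsIn S i j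

IsGamma2t : (n m : ℕ) → ℕ → Set
IsGamma2t n m k =
  Σ (VSet n m) (λ S → IsTotal2Dom n m S × card S ≡ k)
  × ((S : VSet n m) → IsTotal2Dom n m S → k ≤ card S)

restrict : {n m : ℕ} → VSet n m → Subset n → Subset m → VSet n m
restrict S A B i j = S i j ∧ (lookup A i ∨ lookup B j)

-- Delete the rows outside A and the columns outside B, recording the deleted vertices of S
-- as weights on the remaining columns and rows; every vertex of the r × s grid A × B is still
-- 2-dominated when each weight counts as that many extra vertices of its line. Weights are then
-- absorbed into free grid cells one unit at a time without changing the total. When this is
-- impossible, some line of the grid is nearly empty and a count of row or column loads shows
-- that the total is at least 2r or 2s, the sizes of two full rows or two full columns, which are
-- total 2-dominating. When no weight is left, the grid set itself is total 2-dominating.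
module Submission where

open import Defs
open import Data.Bool using (Bool; true; false; _∧_; _∨_; not; if_then_else_)
open import Data.Bool.Properties using (¬-not; ∧-identityʳ; ∨-zeroʳ)
import Data.Bool.Properties as Boolₚ
open import Data.Empty using (⊥-elim)
open import Data.Fin using (Fin; zero; suc; _≟_; punchIn)
open import Data.Fin.Properties using (punchInᵢ≢i; any?; all?; ¬∀⟶∃¬)
open import Data.Fin.Subset using (Subset; ∣_∣; _∈_; _∉_; ⊤; inside; outside)
open import Data.Fin.Subset.Properties using (_∈?_; ∈⊤; ∣p∣≤n; ∣⊤∣≡n; p⊆q⇒∣p∣≤∣q∣)
open import Data.Nat using (ℕ; zero; suc; pred; _+_; _*_; _≤_; _<_; z≤n; s≤s; _≤?_)
open import Data.Nat.Induction using (<-wellFounded)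
open import Data.Nat.Properties hiding (_≟_)
import Data.Nat.Properties as ℕₚ
open import Data.Nat.Tactic.RingSolver using (solve-∀)
open import Data.Product using (∃₂; Σ-syntax; _×_; _,_; proj₂; swap)
open import Data.Sum using (_⊎_; inj₁; inj₂)
import Data.Sum as Sum
open import Data.Vec using ([]; _∷_; here; there)
import Data.Vec as Vec
open import Data.Vec.Properties using ([]=⇒lookup)
open import Data.Vec.Functional using (removeAt; updateAt)
open import Data.Vec.Functional.Properties using (updateAt-updates; updateAt-minimal)
open import Function using (_∘_; _⇔_; mk⇔; Equivalence)
open import Induction.WellFounded using (Acc; acc)
open import Relation.Binary.PropositionalEquality
open import Relation.Nullary using (yes; no)
open import Relation.Nullary.Decidable using (⌊_⌋; ¬?; _×-dec_)

open import Algebra.Properties.CommutativeMonoid.Sum +-0-commutativeMonoid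
  using (sum; sum-remove; ∑-distrib-+; ∑-comm)

private
  variable
    n m : ℕ

-- Finite sums

sumFin≡sum : (f : Fin n → ℕ) → sumFin f ≡ sum f
sumFin≡sum {zero}  f = refl
sumFin≡sum {suc n} f = cong (f zero +_) (sumFin≡sum (f ∘ suc))

sumFin-cong : {f g : Fin n → ℕ} → (∀ i → f i ≡ g i) → sumFin f ≡ sumFin g
sumFin-cong {zero}  f≗g = refl
sumFin-cong {suc n} f≗g = cong₂ _+_ (f≗g zero) (sumFin-cong (f≗g ∘ suc))

sumFin-mono : {f g : Fin n → ℕ} → (∀ i → f i ≤ g i) → sumFin f ≤ sumFin g
sumFin-mono {zero}  f≤g = z≤n
sumFin-mono {suc n} f≤g = +-mono-≤ (f≤g zero) (sumFin-mono (f≤g ∘ suc))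

sumFin-const : (c : ℕ) → sumFin {n} (λ _ → c) ≡ n * c
sumFin-const {zero}  c = refl
sumFin-const {suc n} c = cong (c +_) (sumFin-const {n} c)

sumFin-zero : sumFin {n} (λ _ → 0) ≡ 0
sumFin-zero {n} = trans (sumFin-const {n} 0) (*-zeroʳ n)

sumFin-distrib-+ : (f g : Fin n → ℕ) → sumFin (λ i → f i + g i) ≡ sumFin f + sumFin g
sumFin-distrib-+ f g = begin
  sumFin (λ i → f i + g i) ≡⟨ sumFin≡sum (λ i → f i + g i) ⟩
  sum (λ i → f i + g i)    ≡⟨ ∑-distrib-+ f g ⟩
  sum f + sum g            ≡⟨ sym (cong₂ _+_ (sumFin≡sum f) (sumFin≡sum g)) ⟩
  sumFin f + sumFin g      ∎
  where open ≡-Reasoning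

sumFin-comm : (h : Fin n → Fin m → ℕ) →
  sumFin (λ i → sumFin (h i)) ≡ sumFin (λ j → sumFin (λ i → h i j))
sumFin-comm h = begin
  sumFin (λ i → sumFin (h i))             ≡⟨ sumFin-cong (sumFin≡sum ∘ h) ⟩
  sumFin (λ i → sum (h i))                ≡⟨ sumFin≡sum (λ i → sum (h i)) ⟩
  sum (λ i → sum (h i))                   ≡⟨ ∑-comm h ⟩
  sum (λ j → sum (λ i → h i j))           ≡⟨ sym (sumFin≡sum (λ j → sum (λ i → h i j))) ⟩
  sumFin (λ j → sum (λ i → h i j))        ≡⟨ sym (sumFin-cong (λ j → sumFin≡sum (λ i → h i j))) ⟩
  sumFin (λ j → sumFin (λ i → h i j))     ∎
  where open ≡-Reasoning

sumFin-removeAt : (f : Fin (suc n) → ℕ) (i : Fin (suc n)) →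
  sumFin f ≡ f i + sumFin (removeAt f i)
sumFin-removeAt f i = begin
  sumFin f                    ≡⟨ sumFin≡sum f ⟩
  sum f                       ≡⟨ sum-remove f ⟩
  f i + sum (removeAt f i)    ≡⟨ sym (cong (f i +_) (sumFin≡sum (removeAt f i))) ⟩
  f i + sumFin (removeAt f i) ∎
  where open ≡-Reasoning

sumFin-select : (a : Fin n) (h : Fin n → ℕ) →
  sumFin (λ i → if ⌊ a ≟ i ⌋ then h i else 0) ≡ h a
sumFin-select {suc n} a h = begin
  sumFin δh                         ≡⟨ sumFin-removeAt δh a ⟩
  δh a + sumFin (removeAt δh a)     ≡⟨ cong₂ _+_ (at-a a refl) (trans (sumFin-cong off-a) (sumFin-zero {n})) ⟩
  h a + 0                           ≡⟨ +-identityʳ (h a) ⟩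
  h a                               ∎
  where
  open ≡-Reasoning
  δh : Fin (suc n) → ℕ
  δh i = if ⌊ a ≟ i ⌋ then h i else 0
  at-a : ∀ i → a ≡ i → δh i ≡ h a
  at-a i a≡i with a ≟ i
  ... | yes refl = refl
  ... | no a≢i = ⊥-elim (a≢i a≡i)
  off-a : ∀ j → δh (punchIn a j) ≡ 0
  off-a j with a ≟ punchIn a j
  ... | yes a≡ = ⊥-elim (punchInᵢ≢i a j (sym a≡))
  ... | no _ = refl

sumFin-≥ : {f : Fin n → ℕ} (q : ℕ) → (∀ i → q ≤ f i) → n * q ≤ sumFin f
sumFin-≥ {n} q q≤f = subst (_≤ _) (sumFin-const {n} q) (sumFin-mono q≤f)

sumFin-≥-removeAt : {f : Fin (suc n) → ℕ} (i : Fin (suc n)) (p q : ℕ) →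
  p ≤ f i → (∀ j → q ≤ f (punchIn i j)) → p + n * q ≤ sumFin f
sumFin-≥-removeAt {n} {f} i p q p≤ q≤ =
  subst (p + n * q ≤_) (sym (sumFin-removeAt f i)) (+-mono-≤ p≤ (sumFin-≥ q q≤))

sumFin-point : (f : Fin n → ℕ) (i : Fin n) → f i ≤ sumFin f
sumFin-point {suc n} f i = subst (f i ≤_) (sym (sumFin-removeAt f i)) (m≤m+n (f i) _)

sumFin-updateAt-pred : (f : Fin n → ℕ) (i : Fin n) {k : ℕ} → f i ≡ suc k →
  suc (sumFin (updateAt f i pred)) ≡ sumFin f
sumFin-updateAt-pred {suc n} f i {k} fi≡1+k = begin
  suc (sumFin f′)                        ≡⟨ cong suc (sumFin-removeAt f′ i) ⟩
  suc (f′ i + sumFin (removeAt f′ i))    ≡⟨ cong₂ (λ x y → suc (x + y)) f′i≡k (sumFin-cong off-i) ⟩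
  suc k + sumFin (removeAt f i)          ≡⟨ cong (_+ sumFin (removeAt f i)) fi≡1+k ⟨
  f i + sumFin (removeAt f i)            ≡⟨ sumFin-removeAt f i ⟨
  sumFin f                               ∎
  where
  open ≡-Reasoning
  f′ : Fin (suc n) → ℕ
  f′ = updateAt f i pred
  f′i≡k : f′ i ≡ k
  f′i≡k = trans (updateAt-updates i f) (cong pred fi≡1+k)
  off-i : ∀ j → f′ (punchIn i j) ≡ f (punchIn i j)
  off-i j = updateAt-minimal (punchIn i j) i f (punchInᵢ≢i i j)

ind-∧ : (e u : Bool) → ind (e ∧ u) ≡ (if e then ind u else 0)
ind-∧ false u = refl
ind-∧ true  u = refl

sumFin-∧ : (e : Bool) (P : Fin n → Bool) →
  sumFin (λ j → ind (e ∧ P j)) ≡ (if e then sumFin (λ j → ind (P j)) else 0)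
sumFin-∧ {n} false P = sumFin-zero {n}
sumFin-∧ true  P = refl

sumFin-select-∧ : (a : Fin n) (P : Fin n → Bool) → sumFin (λ i → ind (⌊ a ≟ i ⌋ ∧ P i)) ≡ ind (P a)
sumFin-select-∧ a P = trans (sumFin-cong (λ i → ind-∧ ⌊ a ≟ i ⌋ (P i)))
                            (sumFin-select a (λ i → ind (P i)))

sumFin-∧-≟ : (e : Bool) (b : Fin m) → sumFin (λ j → ind (e ∧ ⌊ b ≟ j ⌋)) ≡ ind e
sumFin-∧-≟ {m} false b = sumFin-zero {m}
sumFin-∧-≟     true  b = sumFin-select b (λ _ → 1)

-- Rows, columns and neighbours

sumGrid : (Fin n → Fin m → ℕ) → ℕ
sumGrid h = sumFin (λ i → sumFin (h i))

sumGrid-cong : {h k : Fin n → Fin m → ℕ} → (∀ i j → h i j ≡ k i j) → sumGrid h ≡ sumGrid k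
sumGrid-cong h≗k = sumFin-cong (λ i → sumFin-cong (h≗k i))

sumGrid-distrib-+ : (h k : Fin n → Fin m → ℕ) →
  sumGrid (λ i j → h i j + k i j) ≡ sumGrid h + sumGrid k
sumGrid-distrib-+ h k = trans (sumFin-cong (λ i → sumFin-distrib-+ (h i) (k i)))
                              (sumFin-distrib-+ (λ i → sumFin (h i)) (λ i → sumFin (k i)))

sumGrid-selectRow : (a : Fin n) (Q : Fin n → Fin m → Bool) →
  sumGrid (λ i j → ind (⌊ a ≟ i ⌋ ∧ Q i j)) ≡ sumFin (λ j → ind (Q a j))
sumGrid-selectRow a Q = trans (sumFin-cong (λ i → sumFin-∧ ⌊ a ≟ i ⌋ (Q i)))
                              (sumFin-select a (λ i → sumFin (λ j → ind (Q i j))))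

rowCount : VSet n m → Fin n → ℕ
rowCount U a = sumFin (λ b → ind (U a b))

colCount : VSet n m → Fin m → ℕ
colCount U b = sumFin (λ a → ind (U a b))

card≡sum-colCount : (U : VSet n m) → card U ≡ sumFin (colCount U)
card≡sum-colCount U = sumFin-comm (λ a b → ind (U a b))

adj-count : (e f u : Bool) →
  ind (((e ∧ not f) ∨ (f ∧ not e)) ∧ u) + (ind (e ∧ f ∧ u) + ind (e ∧ f ∧ u))
    ≡ ind (e ∧ u) + ind (f ∧ u)
adj-count false false u     = refl
adj-count false true  false = refl
adj-count false true  true  = refl
adj-count true  false false = refl
adj-count true  false true  = refl
adj-count true  true  false = refl
adj-count true  true  true  = refl

-- Each neighbour of (a, b) lies in row a or in column b, and (a, b) itself lies in both.
nbrsIn+twice≡rowCount+colCount : (U : VSet n m) (a : Fin n) (b : Fin m) →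
  nbrsIn U a b + (ind (U a b) + ind (U a b)) ≡ rowCount U a + colCount U b
nbrsIn+twice≡rowCount+colCount U a b = begin
  nbrsIn U a b + (ind (U a b) + ind (U a b))
    ≡⟨ cong (λ d → nbrsIn U a b + (d + d)) (sym diagonal) ⟩
  nbrsIn U a b + (sumGrid cell + sumGrid cell)
    ≡⟨ cong (nbrsIn U a b +_) (sym (sumGrid-distrib-+ cell cell)) ⟩
  nbrsIn U a b + sumGrid (λ i j → cell i j + cell i j)
    ≡⟨ sym (sumGrid-distrib-+ (λ i j → ind (adj a b i j ∧ U i j)) _) ⟩
  sumGrid (λ i j → ind (adj a b i j ∧ U i j) + (cell i j + cell i j))
    ≡⟨ sumGrid-cong (λ i j → adj-count ⌊ a ≟ i ⌋ ⌊ b ≟ j ⌋ (U i j)) ⟩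
  sumGrid (λ i j → ind (⌊ a ≟ i ⌋ ∧ U i j) + ind (⌊ b ≟ j ⌋ ∧ U i j))
    ≡⟨ sumGrid-distrib-+ (λ i j → ind (⌊ a ≟ i ⌋ ∧ U i j)) _ ⟩
  sumGrid (λ i j → ind (⌊ a ≟ i ⌋ ∧ U i j)) + sumGrid (λ i j → ind (⌊ b ≟ j ⌋ ∧ U i j))
    ≡⟨ cong₂ _+_ (sumGrid-selectRow a U) (sumFin-cong (λ i → sumFin-select-∧ b (U i))) ⟩
  rowCount U a + colCount U b
    ∎
  where
  open ≡-Reasoning
  cell : Fin _ → Fin _ → ℕ
  cell i j = ind (⌊ a ≟ i ⌋ ∧ ⌊ b ≟ j ⌋ ∧ U i j)
  diagonal : sumGrid cell ≡ ind (U a b)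
  diagonal = trans (sumGrid-selectRow a (λ i j → ⌊ b ≟ j ⌋ ∧ U i j)) (sumFin-select-∧ b (U a))

-- Weighted vertex sets

-- A vertex set of the grid in which row a (column b) carries rowWeight a
-- (colWeight b) further vertices lying outside the grid.
record Weighted (n m : ℕ) : Set where
  constructor weighted
  field
    cells     : VSet n m
    rowWeight : Fin n → ℕ
    colWeight : Fin m → ℕ

open Weighted public

unweighted : VSet n m → Weighted n m
unweighted U = weighted U (λ _ → 0) (λ _ → 0)

transpose : Weighted n m → Weighted m n
transpose c = weighted (λ b a → cells c a b) (colWeight c) (rowWeight c)

rowLoad : Weighted n m → Fin n → ℕ
rowLoad c a = rowCount (cells c) a + rowWeight c a

colLoad : Weighted n m → Fin m → ℕ
colLoad c b = colCount (cells c) b + colWeight c b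

load : Weighted n m → Fin n → Fin m → ℕ
load c a b = rowLoad c a + colLoad c b

-- A vertex is counted once in its row and once in its column, so (a, b) has at least
-- two neighbours exactly when its load is at least 2 plus twice its own membership.
demand : Bool → ℕ
demand u = 2 + (ind u + ind u)

Covered : Weighted n m → Fin n → Fin m → Set
Covered c a b = demand (cells c a b) ≤ load c a b

Dominated : Weighted n m → Set
Dominated c = ∀ a b → Covered c a b

extra : Weighted n m → ℕ
extra c = sumFin (rowWeight c) + sumFin (colWeight c)

weight : Weighted n m → ℕ
weight c = card (cells c) + extra c

2≤load : (c : Weighted n m) {a : Fin n} {b : Fin m} → Covered c a b → 2 ≤ load c a b
2≤load c = ≤-trans (m≤m+n 2 _)

demand≤4 : (u : Bool) → demand u ≤ 4
demand≤4 false = s≤s (s≤s z≤n)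
demand≤4 true  = ≤-refl

covered-unweighted⇔ : (U : VSet n m) (a : Fin n) (b : Fin m) →
  Covered (unweighted U) a b ⇔ 2 ≤ nbrsIn U a b
covered-unweighted⇔ U a b = mk⇔
  (λ cov → +-cancelʳ-≤ twice 2 (nbrsIn U a b) (subst (demand (U a b) ≤_) load≡ cov))
  (λ 2≤ → subst (demand (U a b) ≤_) (sym load≡) (+-monoˡ-≤ twice 2≤))
  where
  twice : ℕ
  twice = ind (U a b) + ind (U a b)
  load≡ : load (unweighted U) a b ≡ nbrsIn U a b + twice
  load≡ = trans (cong₂ _+_ (+-identityʳ (rowCount U a)) (+-identityʳ (colCount U b)))
                (sym (nbrsIn+twice≡rowCount+colCount U a b))

transpose-covered : (c : Weighted n m) {a : Fin n} {b : Fin m} →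
  Covered c a b → Covered (transpose c) b a
transpose-covered c {a} {b} = subst (demand (cells c a b) ≤_) (+-comm (rowLoad c a) (colLoad c b))

transpose-dominated : (c : Weighted n m) → Dominated c → Dominated (transpose c)
transpose-dominated c dom b a = transpose-covered c (dom a b)

extra-transpose : (c : Weighted n m) → extra (transpose c) ≡ extra c
extra-transpose c = +-comm (sumFin (colWeight c)) (sumFin (rowWeight c))

weight-transpose : (c : Weighted n m) → weight (transpose c) ≡ weight c
weight-transpose c = cong₂ _+_ (sym (card≡sum-colCount (cells c))) (extra-transpose c)

weight-unweighted : (U : VSet n m) → weight (unweighted U) ≡ card U
weight-unweighted {n} {m} U =
  trans (cong (card U +_) (cong₂ _+_ (sumFin-zero {n}) (sumFin-zero {m}))) (+-identityʳ (card U))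

sumFin-rowLoad≤weight : (c : Weighted n m) → sumFin (rowLoad c) ≤ weight c
sumFin-rowLoad≤weight c = begin
  sumFin (rowLoad c)                                      ≡⟨ sumFin-distrib-+ (rowCount (cells c)) (rowWeight c) ⟩
  card (cells c) + sumFin (rowWeight c)                   ≤⟨ +-monoʳ-≤ (card (cells c)) (m≤m+n _ _) ⟩
  weight c                                                ∎
  where open ≤-Reasoning

sumFin-colLoad≤weight : (c : Weighted n m) → sumFin (colLoad c) ≤ weight c
sumFin-colLoad≤weight c =
  subst (sumFin (colLoad c) ≤_) (weight-transpose c) (sumFin-rowLoad≤weight (transpose c))

Heavy : Weighted n m → Set
Heavy {n} {m} c = n * 2 ≤ weight c ⊎ m * 2 ≤ weight c

transpose-heavy : (c : Weighted n m) → Heavy (transpose c) → Heavy c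
transpose-heavy {n} {m} c (inj₁ h) = inj₂ (subst (m * 2 ≤_) (weight-transpose c) h)
transpose-heavy {n} {m} c (inj₂ h) = inj₁ (subst (n * 2 ≤_) (weight-transpose c) h)

-- An empty column forces load 2 on every row.
emptyColumn⇒heavy : (c : Weighted n m) → Dominated c → (b : Fin m) → colLoad c b ≡ 0 →
  n * 2 ≤ weight c
emptyColumn⇒heavy c dom b colLoad≡0 =
  ≤-trans (sumFin-≥ 2 2≤rowLoad) (sumFin-rowLoad≤weight c)
  where
  2≤rowLoad : ∀ a → 2 ≤ rowLoad c a
  2≤rowLoad a = subst (2 ≤_) (trans (cong (rowLoad c a +_) colLoad≡0) (+-identityʳ _))
                      (2≤load c (dom a b))

PositiveLoads : Weighted n m → Set
PositiveLoads c = (∀ a → 1 ≤ rowLoad c a) × (∀ b → 1 ≤ colLoad c b)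

heavy-or-positiveLoads : (c : Weighted n m) → Dominated c → Heavy c ⊎ PositiveLoads c
heavy-or-positiveLoads {n} {m} c dom with any? (λ b → colLoad c b ℕₚ.≟ 0)
... | yes (b , colLoad≡0) = inj₁ (inj₁ (emptyColumn⇒heavy c dom b colLoad≡0))
... | no noEmptyColumn with any? (λ a → rowLoad c a ℕₚ.≟ 0)
...   | yes (a , rowLoad≡0) = inj₁ (inj₂ (subst (m * 2 ≤_) (weight-transpose c)
          (emptyColumn⇒heavy (transpose c) (transpose-dominated c dom) a rowLoad≡0)))
...   | no noEmptyRow = inj₂ ( (λ a → n≢0⇒n>0 (λ e → noEmptyRow (a , e)))
                             , (λ b → n≢0⇒n>0 (λ e → noEmptyColumn (b , e))) )

-- Absorbing weights

insertCell : VSet n m → Fin n → Fin m → VSet n m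
insertCell U a b i j = (⌊ a ≟ i ⌋ ∧ ⌊ b ≟ j ⌋) ∨ U i j

absorb : Weighted n m → Fin n → Fin m → Weighted n m
absorb c a b = weighted (insertCell (cells c) a b) (rowWeight c) (updateAt (colWeight c) b pred)

module Absorption (c : Weighted n m) {a : Fin n} {b : Fin m} {k : ℕ}
                  (free : cells c a b ≡ false) (positive : colWeight c b ≡ suc k) where

  private
    U : VSet n m
    U = cells c

  ind-insertCell : ∀ i j → ind (insertCell U a b i j) ≡ ind (⌊ a ≟ i ⌋ ∧ ⌊ b ≟ j ⌋) + ind (U i j)
  ind-insertCell i j with a ≟ i | b ≟ j
  ... | yes refl | yes refl rewrite free = refl
  ... | yes _    | no _     = refl
  ... | no _     | _        = refl

  rowCount-insertCell : ∀ i → rowCount (insertCell U a b) i ≡ ind ⌊ a ≟ i ⌋ + rowCount U i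
  rowCount-insertCell i = begin
    rowCount (insertCell U a b) i
      ≡⟨ sumFin-cong (ind-insertCell i) ⟩
    sumFin (λ j → ind (⌊ a ≟ i ⌋ ∧ ⌊ b ≟ j ⌋) + ind (U i j))
      ≡⟨ sumFin-distrib-+ (λ j → ind (⌊ a ≟ i ⌋ ∧ ⌊ b ≟ j ⌋)) (λ j → ind (U i j)) ⟩
    sumFin (λ j → ind (⌊ a ≟ i ⌋ ∧ ⌊ b ≟ j ⌋)) + rowCount U i
      ≡⟨ cong (_+ rowCount U i) (sumFin-∧-≟ ⌊ a ≟ i ⌋ b) ⟩
    ind ⌊ a ≟ i ⌋ + rowCount U i
      ∎
    where open ≡-Reasoning

  colCount-insertCell : ∀ j → colCount (insertCell U a b) j ≡ ind ⌊ b ≟ j ⌋ + colCount U j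
  colCount-insertCell j = begin
    colCount (insertCell U a b) j
      ≡⟨ sumFin-cong (λ i → ind-insertCell i j) ⟩
    sumFin (λ i → ind (⌊ a ≟ i ⌋ ∧ ⌊ b ≟ j ⌋) + ind (U i j))
      ≡⟨ sumFin-distrib-+ (λ i → ind (⌊ a ≟ i ⌋ ∧ ⌊ b ≟ j ⌋)) (λ i → ind (U i j)) ⟩
    sumFin (λ i → ind (⌊ a ≟ i ⌋ ∧ ⌊ b ≟ j ⌋)) + colCount U j
      ≡⟨ cong (_+ colCount U j) (sumFin-select-∧ a (λ _ → ⌊ b ≟ j ⌋)) ⟩
    ind ⌊ b ≟ j ⌋ + colCount U j
      ∎
    where open ≡-Reasoning

  load-absorb : ∀ i j → load (absorb c a b) i j ≡ ind ⌊ a ≟ i ⌋ + load c i j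
  load-absorb i j = begin
    load (absorb c a b) i j
      ≡⟨ cong₂ (λ r s → (r + rowWeight c i) + (s + colWeight′ j))
               (rowCount-insertCell i) (colCount-insertCell j) ⟩
    (ind ⌊ a ≟ i ⌋ + rowCount U i + rowWeight c i) + (ind ⌊ b ≟ j ⌋ + colCount U j + colWeight′ j)
      ≡⟨ cong₂ _+_ (+-assoc (ind ⌊ a ≟ i ⌋) _ _) (column-unchanged j) ⟩
    (ind ⌊ a ≟ i ⌋ + rowLoad c i) + colLoad c j
      ≡⟨ +-assoc (ind ⌊ a ≟ i ⌋) _ _ ⟩
    ind ⌊ a ≟ i ⌋ + load c i j
      ∎
    where
    open ≡-Reasoning
    colWeight′ : Fin m → ℕ
    colWeight′ = updateAt (colWeight c) b pred
    column-unchanged : ∀ j → ind ⌊ b ≟ j ⌋ + colCount U j + colWeight′ j ≡ colLoad c j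
    column-unchanged j with b ≟ j
    ... | yes refl = begin
      suc (colCount U b) + colWeight′ b ≡⟨ cong (suc (colCount U b) +_) (updateAt-updates b (colWeight c)) ⟩
      suc (colCount U b) + pred (colWeight c b) ≡⟨ cong (λ w → suc (colCount U b) + pred w) positive ⟩
      suc (colCount U b + k)            ≡⟨ +-suc (colCount U b) k ⟨
      colCount U b + suc k              ≡⟨ cong (colCount U b +_) positive ⟨
      colLoad c b                       ∎
    ... | no b≢j = cong (colCount U j +_) (updateAt-minimal j b (colWeight c) (b≢j ∘ sym))

  card-insertCell : card (insertCell U a b) ≡ suc (card U)
  card-insertCell =
    trans (sumFin-cong rowCount-insertCell)
   (trans (sumFin-distrib-+ (λ i → ind ⌊ a ≟ i ⌋) (rowCount U))
          (cong (_+ card U) (sumFin-select a (λ _ → 1))))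

  extra-absorb : suc (extra (absorb c a b)) ≡ extra c
  extra-absorb = begin
    suc (sumFin (rowWeight c) + sumFin colWeight′) ≡⟨ +-suc (sumFin (rowWeight c)) _ ⟨
    sumFin (rowWeight c) + suc (sumFin colWeight′) ≡⟨ cong (sumFin (rowWeight c) +_) (sumFin-updateAt-pred (colWeight c) b positive) ⟩
    extra c                                       ∎
    where
    open ≡-Reasoning
    colWeight′ : Fin m → ℕ
    colWeight′ = updateAt (colWeight c) b pred

  weight-absorb : weight (absorb c a b) ≡ weight c
  weight-absorb = begin
    card (insertCell U a b) + extra (absorb c a b) ≡⟨ cong (_+ extra (absorb c a b)) card-insertCell ⟩
    suc (card U + extra (absorb c a b))            ≡⟨ +-suc (card U) _ ⟨
    card U + suc (extra (absorb c a b))            ≡⟨ cong (card U +_) extra-absorb ⟩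
    weight c                                       ∎
    where open ≡-Reasoning

record Improvement (c : Weighted n m) : Set where
  constructor improvement
  field
    next             : Weighted n m
    next-dominated   : Dominated next
    extra-decreases  : extra next < extra c
    weight-unchanged : weight next ≡ weight c

transpose-improvement : (c : Weighted n m) → Improvement (transpose c) → Improvement c
transpose-improvement c (improvement c′ dom′ extra< weight≡) = improvement
  (transpose c′)
  (transpose-dominated c′ dom′)
  (subst₂ _<_ (sym (extra-transpose c′)) (extra-transpose c) extra<)
  (trans (weight-transpose c′) (trans weight≡ (weight-transpose c)))

absorb-improvement : (c : Weighted n m) {a : Fin n} {b : Fin m} {k : ℕ} → Dominated c →
  cells c a b ≡ false → colWeight c b ≡ suc k → 3 ≤ load c a b → Improvement c
absorb-improvement c {a} {b} dom free positive 3≤load =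
  improvement (absorb c a b) dominated (≤-reflexive extra-absorb) weight-absorb
  where
  open Absorption c free positive
  covered : ∀ i j → demand (insertCell (cells c) a b i j) ≤ ind ⌊ a ≟ i ⌋ + load c i j
  covered i j with a ≟ i | b ≟ j
  ... | yes refl | yes refl = s≤s 3≤load
  ... | yes refl | no _     = m≤n⇒m≤1+n (dom i j)
  ... | no _     | _        = dom i j
  dominated : Dominated (absorb c a b)
  dominated i j = subst (demand (insertCell (cells c) a b i j) ≤_) (sym (load-absorb i j)) (covered i j)

-- Two absorptions in the same row raise the load of the whole row by 2,
-- which covers any demand without a hypothesis on the loads.
absorbTwice-improvement : (c : Weighted n m) {a : Fin n} {b b′ : Fin m} {k k′ : ℕ} →
  Dominated c → b ≢ b′ → cells c a b ≡ false → cells c a b′ ≡ false →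
  colWeight c b ≡ suc k → colWeight c b′ ≡ suc k′ → Improvement c
absorbTwice-improvement {n} {m} c {a} {b} {b′} {k′ = k′} dom b≢b′ free free′ positive positive′ =
  improvement c₂ dominated
    (<-trans (≤-reflexive second.extra-absorb) (≤-reflexive first.extra-absorb))
    (trans second.weight-absorb first.weight-absorb)
  where
  c₁ c₂ : Weighted n m
  c₁ = absorb c a b
  c₂ = absorb c₁ a b′
  free₁ : cells c₁ a b′ ≡ false
  free₁ with a ≟ a | b ≟ b′
  ... | _     | yes b≡b′ = ⊥-elim (b≢b′ b≡b′)
  ... | yes _ | no _     = free′
  ... | no _  | no _     = free′
  positive₁ : colWeight c₁ b′ ≡ suc k′
  positive₁ = trans (updateAt-minimal b′ b (colWeight c) (b≢b′ ∘ sym)) positive′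
  module first  = Absorption c free positive
  module second = Absorption c₁ free₁ positive₁
  covered : ∀ e {f f′} u {l} → 2 ≤ l → demand u ≤ l →
    demand ((e ∧ f′) ∨ ((e ∧ f) ∨ u)) ≤ ind e + (ind e + l)
  covered true {f} {f′} u 2≤l _ = ≤-trans (demand≤4 (f′ ∨ (f ∨ u))) (+-monoʳ-≤ 2 2≤l)
  covered false u _ cov = cov
  dominated : Dominated c₂
  dominated i j = subst (demand (cells c₂ i j) ≤_)
    (sym (trans (second.load-absorb i j) (cong (ind ⌊ a ≟ i ⌋ +_) (first.load-absorb i j))))
    (covered ⌊ a ≟ i ⌋ (cells c i j) (2≤load c (dom i j)) (dom i j))

ind≤0⇒false : {u : Bool} → ind u ≤ 0 → u ≡ false
ind≤0⇒false {false} _ = refl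

1≤⇒≡suc-pred : {w : ℕ} → 1 ≤ w → w ≡ suc (pred w)
1≤⇒≡suc-pred {suc w} _ = refl

n*2≡n+n : (n : ℕ) → n * 2 ≡ n + n
n*2≡n+n n = trans (*-comm n 2) (cong (n +_) (+-identityʳ n))

n+m≤⇒heavy : {w : ℕ} → n + m ≤ w → n * 2 ≤ w ⊎ m * 2 ≤ w
n+m≤⇒heavy {n} {m} {w} n+m≤w with ≤-total n m
... | inj₁ n≤m = inj₁ (subst (_≤ w) (sym (n*2≡n+n n)) (≤-trans (+-monoʳ-≤ n n≤m) n+m≤w))
... | inj₂ m≤n = inj₂ (subst (_≤ w) (sym (n*2≡n+n m)) (≤-trans (+-monoˡ-≤ m m≤n) n+m≤w))

-- A full column of positive weight has load above n; every other column has load at least 1.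
fullColumn⇒heavy : (c : Weighted n m) (b : Fin m) {k : ℕ} → (∀ a → cells c a b ≡ true) →
  colWeight c b ≡ suc k → (∀ j → 1 ≤ colLoad c j) → Heavy c
fullColumn⇒heavy {n} {suc m} c b {k} full positive colPos = n+m≤⇒heavy (begin
  n + suc m           ≡⟨ +-suc n m ⟩
  suc n + m           ≡⟨ cong (suc n +_) (*-identityʳ m) ⟨
  suc n + m * 1       ≤⟨ sumFin-≥-removeAt {f = colLoad c} b (suc n) 1 1+n≤colLoad (colPos ∘ punchIn b) ⟩
  sumFin (colLoad c)  ≤⟨ sumFin-colLoad≤weight c ⟩
  weight c            ∎)
  where
  open ≤-Reasoning
  colCount≡n : colCount (cells c) b ≡ n
  colCount≡n = trans (sumFin-cong (λ a → cong ind (full a))) (trans (sumFin-const {n} 1) (*-identityʳ n))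
  1+n≤colLoad : suc n ≤ colLoad c b
  1+n≤colLoad = begin
    suc n                                     ≡⟨ +-comm 1 n ⟩
    n + 1                                     ≤⟨ +-monoʳ-≤ n (s≤s z≤n) ⟩
    n + suc k                                 ≡⟨ cong₂ _+_ colCount≡n positive ⟨
    colLoad c b                               ∎

-- A free cell of load at most 2 in a column of positive weight forces that column to have load 1,
-- hence no cells, and then every row has load 1.
emptyColumn×thinRows : (c : Weighted n m) → PositiveLoads c → {b : Fin m} {k : ℕ} →
  colWeight c b ≡ suc k → (∀ a → cells c a b ≡ false → load c a b ≤ 2) →
  (a₁ : Fin n) → cells c a₁ b ≡ false →
  (∀ a → cells c a b ≡ false) × (∀ a → rowLoad c a ≤ 1)
emptyColumn×thinRows c (rowPos , colPos) {b} {k} positive unabsorbable a₁ free₁ =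
  empty , λ a → +-cancelʳ-≤ 1 (rowLoad c a) 1
                  (≤-trans (+-monoʳ-≤ (rowLoad c a) (colPos b)) (unabsorbable a (empty a)))
  where
  colLoad≤1 : colLoad c b ≤ 1
  colLoad≤1 = ≤-pred (≤-trans (+-monoˡ-≤ (colLoad c b) (rowPos a₁)) (unabsorbable a₁ free₁))
  colCount≡0 : colCount (cells c) b ≡ 0
  colCount≡0 = n≤0⇒n≡0 (m+n≤o⇒m≤o _ (≤-pred (subst (_≤ 1)
    (trans (cong (colCount (cells c) b +_) positive) (+-suc _ k)) colLoad≤1)))
  empty : ∀ a → cells c a b ≡ false
  empty a = ind≤0⇒false (subst (ind (cells c a b) ≤_) colCount≡0
                                (sumFin-point (λ a′ → ind (cells c a′ b)) a))

-- With all rows of load 1, a column carrying a cell has load at least 3, while an empty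
-- column other than b allows absorbing in two columns at once.
thinRows⇒improvement-or-heavy : ∀ {n m} → 2 ≤ m → (c : Weighted n m) → Dominated c → PositiveLoads c →
  {b : Fin m} {k : ℕ} → colWeight c b ≡ suc k → (∀ a → cells c a b ≡ false) →
  (∀ a → rowLoad c a ≤ 1) → Fin n → Improvement c ⊎ Heavy c
thinRows⇒improvement-or-heavy {n} {suc m} m≥2 c dom (_ , colPos) {b} positive emptyB thin a₁
  with any? (λ j → ¬? (j ≟ b) ×-dec all? (λ a → cells c a j Boolₚ.≟ false))
... | yes (j , j≢b , emptyJ) = inj₁ (absorbTwice-improvement c dom (j≢b ∘ sym) (emptyB a₁) (emptyJ a₁)
        positive (1≤⇒≡suc-pred (subst (1 ≤_) colLoad≡colWeight (colPos j))))
  where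
  colLoad≡colWeight : colLoad c j ≡ colWeight c j
  colLoad≡colWeight = cong (_+ colWeight c j)
    (trans (sumFin-cong (λ a → cong ind (emptyJ a))) (sumFin-zero {n}))
... | no noEmptyColumn = inj₂ (inj₂ (begin
  suc m * 2                ≤⟨ arithmetic m≥2 ⟩
  1 + m * 3                ≤⟨ sumFin-≥-removeAt {f = colLoad c} b 1 3 (colPos b) (λ j → 3≤colLoad (punchInᵢ≢i b j)) ⟩
  sumFin (colLoad c)       ≤⟨ sumFin-colLoad≤weight c ⟩
  weight c                 ∎))
  where
  open ≤-Reasoning
  arithmetic : {m : ℕ} → 2 ≤ suc m → suc m * 2 ≤ 1 + m * 3
  arithmetic {zero}  (s≤s ())
  arithmetic {suc m} _ = s≤s (s≤s (s≤s (s≤s (*-monoʳ-≤ m (s≤s (s≤s z≤n))))))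
  3≤colLoad : {j : Fin (suc m)} → j ≢ b → 3 ≤ colLoad c j
  3≤colLoad {j} j≢b with ¬∀⟶∃¬ n _ (λ a → cells c a j Boolₚ.≟ false) (λ emptyJ → noEmptyColumn (j , j≢b , emptyJ))
  ... | (a , occupied) = ≤-pred (≤-trans
          (subst (λ u → demand u ≤ load c a j) (¬-not occupied) (dom a j))
          (+-monoˡ-≤ (colLoad c j) (thin a)))

absorbColumnWeight : 2 ≤ m → (c : Weighted n m) → Dominated c → PositiveLoads c →
  (b : Fin m) {k : ℕ} → colWeight c b ≡ suc k → Improvement c ⊎ Heavy c
absorbColumnWeight {m} {n} m≥2 c dom pos b positive
  with any? (λ a → (cells c a b Boolₚ.≟ false) ×-dec (3 ≤? load c a b))
... | yes (a , free , 3≤load) = inj₁ (absorb-improvement c dom free positive 3≤load)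
... | no noAbsorbable with all? (λ a → cells c a b Boolₚ.≟ true)
...   | yes full = inj₂ (fullColumn⇒heavy c b full positive (proj₂ pos))
...   | no notFull with ¬∀⟶∃¬ n _ (λ a → cells c a b Boolₚ.≟ true) notFull
...     | (a₁ , notTrue) with emptyColumn×thinRows c pos positive
          (λ a free → ≤-pred (≰⇒> (λ 3≤load → noAbsorbable (a , free , 3≤load)))) a₁ (¬-not notTrue)
...       | (emptyB , thin) = thinRows⇒improvement-or-heavy m≥2 c dom pos positive emptyB thin a₁

zero-or-positive : (f : Fin n → ℕ) → (∀ i → f i ≡ 0) ⊎ ∃₂ λ i k → f i ≡ suc k
zero-or-positive {zero}  f = inj₁ λ ()
zero-or-positive {suc n} f with f zero in f0≡ | zero-or-positive (f ∘ suc)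
... | suc k | _                   = inj₂ (zero , k , f0≡)
... | zero  | inj₁ rest≡0          = inj₁ λ { zero → f0≡ ; (suc i) → rest≡0 i }
... | zero  | inj₂ (i , k , fi≡)  = inj₂ (suc i , k , fi≡)

unweighted-dominated : (c : Weighted n m) → Dominated c →
  (∀ a → rowWeight c a ≡ 0) → (∀ b → colWeight c b ≡ 0) → Dominated (unweighted (cells c))
unweighted-dominated c dom row≡0 col≡0 a b = subst (demand (cells c a b) ≤_)
  (cong₂ (λ x y → (rowCount (cells c) a + x) + (colCount (cells c) b + y)) (row≡0 a) (col≡0 b))
  (dom a b)

unweighted-dominated⇒total2Dom : (U : VSet n m) → Dominated (unweighted U) → IsTotal2Dom n m U
unweighted-dominated⇒total2Dom U dom a b = Equivalence.to (covered-unweighted⇔ U a b) (dom a b)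

progress : 2 ≤ n → 2 ≤ m → (c : Weighted n m) → Dominated c →
  (Improvement c ⊎ Heavy c) ⊎ IsTotal2Dom n m (cells c)
progress n≥2 m≥2 c dom with heavy-or-positiveLoads c dom
... | inj₁ heavy = inj₁ (inj₂ heavy)
... | inj₂ pos with zero-or-positive (colWeight c) | zero-or-positive (rowWeight c)
...   | inj₂ (b , _ , positive) | _ = inj₁ (absorbColumnWeight m≥2 c dom pos b positive)
...   | inj₁ _ | inj₂ (a , _ , positive) =
        inj₁ (Sum.map (transpose-improvement c) (transpose-heavy c)
                      (absorbColumnWeight n≥2 (transpose c) (transpose-dominated c dom) (swap pos) a positive))
...   | inj₁ col≡0 | inj₁ row≡0 =
        inj₂ (unweighted-dominated⇒total2Dom (cells c) (unweighted-dominated c dom row≡0 col≡0))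

-- The bound for weighted sets on the full grid

firstTwo : Fin n → Bool
firstTwo zero          = true
firstTwo (suc zero)    = true
firstTwo (suc (suc _)) = false

twoRows : VSet n m
twoRows a _ = firstTwo a

sumFin-firstTwo : 2 ≤ n → sumFin (λ (a : Fin n) → ind (firstTwo a)) ≡ 2
sumFin-firstTwo {suc zero}    (s≤s ())
sumFin-firstTwo {suc (suc n)} _ = cong (2 +_) (sumFin-zero {n})

twoRows-dominated : ∀ {n m} → 2 ≤ n → 2 ≤ m → Dominated (unweighted (twoRows {n} {m}))
twoRows-dominated {n} {m} n≥2 m≥2 a b =
  subst (demand (firstTwo a) ≤_) (sym load≡) (bound (firstTwo a))
  where
  load≡ : load (unweighted twoRows) a b ≡ m * ind (firstTwo a) + 2
  load≡ = cong₂ _+_ (trans (+-identityʳ _) (sumFin-const {m} (ind (firstTwo a))))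
                    (trans (+-identityʳ _) (sumFin-firstTwo n≥2))
  bound : ∀ u → demand u ≤ m * ind u + 2
  bound false = m≤n+m 2 (m * 0)
  bound true  = subst (λ x → 4 ≤ x + 2) (sym (*-identityʳ m)) (+-monoˡ-≤ 2 m≥2)

card-twoRows : ∀ {n m} → 2 ≤ n → card (twoRows {n} {m}) ≡ m * 2
card-twoRows {n} {m} n≥2 = trans (card≡sum-colCount (twoRows {n} {m}))
  (trans (sumFin-cong {m} (λ _ → sumFin-firstTwo n≥2)) (sumFin-const {m} 2))

module _ {n m g : ℕ} (n≥2 : 2 ≤ n) (m≥2 : 2 ≤ m) (γ : IsGamma2t n m g) where

  private
    minimal : (U : VSet n m) → IsTotal2Dom n m U → g ≤ card U
    minimal = proj₂ γ

  γ≤m*2 : g ≤ m * 2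
  γ≤m*2 = subst (g ≤_) (card-twoRows {n} {m} n≥2)
    (minimal twoRows (unweighted-dominated⇒total2Dom twoRows (twoRows-dominated {n} {m} n≥2 m≥2)))

  γ≤n*2 : g ≤ n * 2
  γ≤n*2 = subst (g ≤_) (trans (sym (card≡sum-colCount (twoRows {m} {n}))) (card-twoRows {m} {n} m≥2))
    (minimal (λ a b → twoRows b a) (unweighted-dominated⇒total2Dom (λ a b → twoRows b a)
      (transpose-dominated (unweighted (twoRows {m} {n})) (twoRows-dominated {m} {n} m≥2 n≥2))))

  heavy⇒γ≤weight : (c : Weighted n m) → Heavy c → g ≤ weight c
  heavy⇒γ≤weight c (inj₁ n*2≤) = ≤-trans γ≤n*2 n*2≤
  heavy⇒γ≤weight c (inj₂ m*2≤) = ≤-trans γ≤m*2 m*2≤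

  dominated⇒γ≤weight : (c : Weighted n m) → Dominated c → g ≤ weight c
  dominated⇒γ≤weight c = go c (<-wellFounded (extra c))
    where
    go : (c : Weighted n m) → Acc _<_ (extra c) → Dominated c → g ≤ weight c
    go c (acc smaller) dom with progress n≥2 m≥2 c dom
    ... | inj₁ (inj₁ (improvement c′ dom′ extra< weight≡)) = subst (g ≤_) weight≡ (go c′ (smaller extra<) dom′)
    ... | inj₁ (inj₂ heavy) = heavy⇒γ≤weight c heavy
    ... | inj₂ total2Dom    = ≤-trans (minimal (cells c) total2Dom) (m≤m+n (card (cells c)) (extra c))

-- Deleting inactive rows and columns

∈-removeAt : (p : Subset (suc n)) (i : Fin (suc n)) {a : Fin n} →
  a ∈ Vec.removeAt p i → punchIn i a ∈ p
∈-removeAt (x ∷ p)     zero    a∈             = there a∈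
∈-removeAt (x ∷ y ∷ p) (suc i) {zero}  here       = here
∈-removeAt (x ∷ y ∷ p) (suc i) {suc a} (there a∈) = there (∈-removeAt (y ∷ p) i a∈)

∣removeAt∣≡∣p∣ : (p : Subset (suc n)) {i : Fin (suc n)} → i ∉ p → ∣ Vec.removeAt p i ∣ ≡ ∣ p ∣
∣removeAt∣≡∣p∣ (outside ∷ p)     {zero}  _   = refl
∣removeAt∣≡∣p∣ (inside  ∷ p)     {zero}  i∉p = ⊥-elim (i∉p here)
∣removeAt∣≡∣p∣ (outside ∷ y ∷ p) {suc i} i∉p = ∣removeAt∣≡∣p∣ (y ∷ p) (i∉p ∘ there)
∣removeAt∣≡∣p∣ (inside  ∷ y ∷ p) {suc i} i∉p = cong suc (∣removeAt∣≡∣p∣ (y ∷ p) (i∉p ∘ there))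

full⇒∣p∣≡n : (p : Subset n) → (∀ a → a ∈ p) → ∣ p ∣ ≡ n
full⇒∣p∣≡n {n} p full =
  ≤-antisym (∣p∣≤n p) (subst (_≤ ∣ p ∣) (∣⊤∣≡n n) (p⊆q⇒∣p∣≤∣q∣ {p = ⊤} (λ {a} _ → full a)))

DominatedOn : Subset n → Subset m → Weighted n m → Set
DominatedOn A B c = ∀ {a b} → a ∈ A → b ∈ B → Covered c a b

transpose-dominatedOn : (c : Weighted n m) {A : Subset n} {B : Subset m} →
  DominatedOn A B c → DominatedOn B A (transpose c)
transpose-dominatedOn c dom b∈B a∈A = transpose-covered c (dom a∈A b∈B)

deleteRow : Weighted (suc n) m → Fin (suc n) → Weighted n m
deleteRow c i = weighted (λ a b → cells c (punchIn i a) b) (removeAt (rowWeight c) i)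
                         (λ b → colWeight c b + ind (cells c i b))

deleteRow-dominatedOn : (c : Weighted (suc n) m) (i : Fin (suc n)) {A : Subset (suc n)} {B : Subset m} →
  DominatedOn A B c → DominatedOn (Vec.removeAt A i) B (deleteRow c i)
deleteRow-dominatedOn c i {A} dom {a} {b} a∈ b∈ =
  subst (demand (cells c (punchIn i a) b) ≤_) (cong (rowLoad c (punchIn i a) +_) (sym colLoad≡))
        (dom (∈-removeAt A i a∈) b∈)
  where
  colLoad≡ : colLoad (deleteRow c i) b ≡ colLoad c b
  colLoad≡ = begin
    colCount (cells (deleteRow c i)) b + (colWeight c b + ind (cells c i b))
      ≡⟨ cong (colCount (cells (deleteRow c i)) b +_) (+-comm (colWeight c b) _) ⟩
    colCount (cells (deleteRow c i)) b + (ind (cells c i b) + colWeight c b)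
      ≡⟨ +-assoc (colCount (cells (deleteRow c i)) b) _ _ ⟨
    colCount (cells (deleteRow c i)) b + ind (cells c i b) + colWeight c b
      ≡⟨ cong (_+ colWeight c b) (+-comm (colCount (cells (deleteRow c i)) b) _) ⟩
    ind (cells c i b) + colCount (cells (deleteRow c i)) b + colWeight c b
      ≡⟨ cong (_+ colWeight c b) (sumFin-removeAt (λ a → ind (cells c a b)) i) ⟨
    colLoad c b
      ∎
    where open ≡-Reasoning

weight-deleteRow : (c : Weighted (suc n) m) (i : Fin (suc n)) → weight (deleteRow c i) ≤ weight c
weight-deleteRow c i = begin
  card (cells (deleteRow c i)) + (sumFin x′ + sumFin (λ b → colWeight c b + ind (cells c i b)))
    ≡⟨ cong (λ w → C′ + (sumFin x′ + w)) (sumFin-distrib-+ (colWeight c) (λ b → ind (cells c i b))) ⟩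
  C′ + (sumFin x′ + (Y + R))
    ≡⟨ rearrange C′ (sumFin x′) Y R ⟩
  (R + C′) + (sumFin x′ + Y)
    ≤⟨ +-monoʳ-≤ (R + C′) (+-monoˡ-≤ Y (m≤n+m (sumFin x′) (rowWeight c i))) ⟩
  (R + C′) + ((rowWeight c i + sumFin x′) + Y)
    ≡⟨ cong₂ (λ u v → u + (v + Y)) (sumFin-removeAt (rowCount (cells c)) i) (sumFin-removeAt (rowWeight c) i) ⟨
  weight c
    ∎
  where
  open ≤-Reasoning
  x′ : Fin _ → ℕ
  x′ = removeAt (rowWeight c) i
  C′ Y R : ℕ
  C′ = card (cells (deleteRow c i))
  Y  = sumFin (colWeight c)
  R  = rowCount (cells c) i
  rearrange : ∀ c x y r → c + (x + (y + r)) ≡ (r + c) + (x + y)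
  rearrange = solve-∀

ShrunkTo : (r : ℕ) → Subset m → Weighted n m → Set
ShrunkTo {m} r B c = Σ[ c′ ∈ Weighted r m ] DominatedOn ⊤ B c′ × weight c′ ≤ weight c

shrinkFullRows : ∀ {n r} (A : Subset n) {B : Subset m} → (∀ a → a ∈ A) → ∣ A ∣ ≡ r →
  (c : Weighted n m) → DominatedOn A B c → ShrunkTo r B c
shrinkFullRows A full ∣A∣≡r c dom with trans (sym (full⇒∣p∣≡n A full)) ∣A∣≡r
... | refl = c , (λ {a} _ b∈ → dom (full a) b∈) , ≤-refl

shrinkRows : ∀ {n r} (A : Subset n) {B : Subset m} → ∣ A ∣ ≡ r →
  (c : Weighted n m) → DominatedOn A B c → ShrunkTo r B c
shrinkRows {n = zero}  A ∣A∣≡r c dom = shrinkFullRows A (λ ()) ∣A∣≡r c dom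
shrinkRows {n = suc n} A ∣A∣≡r c dom with all? (_∈? A)
... | yes full = shrinkFullRows A full ∣A∣≡r c dom
... | no notFull with ¬∀⟶∃¬ (suc n) (_∈ A) (_∈? A) notFull
...   | (i , i∉A) with shrinkRows (Vec.removeAt A i) (trans (∣removeAt∣≡∣p∣ A i∉A) ∣A∣≡r)
                                  (deleteRow c i) (deleteRow-dominatedOn c i dom)
...     | (c′ , dom′ , weight≤) = c′ , dom′ , ≤-trans weight≤ (weight-deleteRow c i)

shrink : ∀ {n m r s} (A : Subset n) (B : Subset m) → ∣ A ∣ ≡ r → ∣ B ∣ ≡ s →
  (c : Weighted n m) → DominatedOn A B c →
  Σ[ c′ ∈ Weighted r s ] Dominated c′ × weight c′ ≤ weight c
shrink A B ∣A∣≡r ∣B∣≡s c dom with shrinkRows A ∣A∣≡r c dom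
... | (c₁ , dom₁ , weight₁≤) with shrinkRows B ∣B∣≡s (transpose c₁) (transpose-dominatedOn c₁ dom₁)
... | (c₂ , dom₂ , weight₂≤) = transpose c₂ , (λ a b → transpose-covered c₂ (dom₂ ∈⊤ ∈⊤)) , (begin
  weight (transpose c₂) ≡⟨ weight-transpose c₂ ⟩
  weight c₂             ≤⟨ weight₂≤ ⟩
  weight (transpose c₁) ≡⟨ weight-transpose c₁ ⟩
  weight c₁             ≤⟨ weight₁≤ ⟩
  weight c              ∎)
  where open ≤-Reasoning

-- Every neighbour of a vertex of A × B lies in its row or its column, so it survives the restriction.
nbrsIn≤nbrsIn-restrict : (S : VSet n m) (A : Subset n) (B : Subset m) {a : Fin n} {b : Fin m} →
  a ∈ A → b ∈ B → nbrsIn S a b ≤ nbrsIn (restrict S A B) a b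
nbrsIn≤nbrsIn-restrict S A B {a} {b} a∈A b∈B = sumFin-mono (λ i → sumFin-mono (λ j → neighbour i j))
  where
  neighbour : ∀ i j → ind (adj a b i j ∧ S i j) ≤ ind (adj a b i j ∧ restrict S A B i j)
  neighbour i j with a ≟ i | b ≟ j
  ... | yes refl | _        rewrite []=⇒lookup a∈A | ∧-identityʳ (S a j) = ≤-refl
  ... | no _     | yes refl rewrite []=⇒lookup b∈B | ∨-zeroʳ (Vec.lookup A i) | ∧-identityʳ (S i b) = ≤-refl
  ... | no _     | no _     = z≤n

restrict-dominatedOn : (S : VSet n m) (A : Subset n) (B : Subset m) → IsTotal2Dom n m S →
  DominatedOn A B (unweighted (restrict S A B))
restrict-dominatedOn S A B total2Dom {a} {b} a∈A b∈B =
  Equivalence.from (covered-unweighted⇔ (restrict S A B) a b)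
    (≤-trans (total2Dom a b) (nbrsIn≤nbrsIn-restrict S A B a∈A b∈B))

dominatedOn⇒γ≤weight : ∀ {n m r s g} → 2 ≤ r → 2 ≤ s → IsGamma2t r s g →
  (A : Subset n) (B : Subset m) → ∣ A ∣ ≡ r → ∣ B ∣ ≡ s →
  (c : Weighted n m) → DominatedOn A B c → g ≤ weight c
dominatedOn⇒γ≤weight r≥2 s≥2 γ A B ∣A∣≡r ∣B∣≡s c dom with shrink A B ∣A∣≡r ∣B∣≡s c dom
... | (c′ , dom′ , weight≤) = ≤-trans (dominated⇒γ≤weight r≥2 s≥2 γ c′ dom′) weight≤

lemma2p7 : (n m r s : ℕ) → 2 ≤ n → 2 ≤ m → 2 ≤ r → r ≤ n → 2 ≤ s → s ≤ m →
    (A : Subset n) → ∣ A ∣ ≡ r → (B : Subset m) → ∣ B ∣ ≡ s →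
    (S : VSet n m) → IsTotal2Dom n m S →
    (g : ℕ) → IsGamma2t r s g →
    g ≤ card (restrict S A B)
lemma2p7 n m r s _ _ r≥2 _ s≥2 _ A ∣A∣≡r B ∣B∣≡s S total2Dom g γ = begin
  g                                    ≤⟨ dominatedOn⇒γ≤weight r≥2 s≥2 γ A B ∣A∣≡r ∣B∣≡s _
                                            (restrict-dominatedOn S A B total2Dom) ⟩
  weight (unweighted (restrict S A B)) ≡⟨ weight-unweighted (restrict S A B) ⟩
  card (restrict S A B)                ∎
  where open ≤-Reasoning
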